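{- Let $n,k\geq 3$ and let $a_1,\ldots,a_n$ be distinct letters. Let $w=u_1a_1u_2a_1\cdots a_1u_{k-1}a_1u_k$ be a word over $\{a_1,\ldots,a_n\}$ that is rich and square-free, where $u_1,\ldots,u_k$ are words (possibly $u_k=\epsilon$), $a_1$ does not occur in any $u_i$, and $\mathrm{Alph}(u_1)=\{a_2,\ldots,a_n\}$. Then for each $2\leq i\leq k-1$, the word $u_i$ is an odd-length palindrome, $u_i=v_ib_i\widetilde{v_i}$ with $b_i$ a letter, and $$\mathrm{Alph}(u_{i+1})\subseteq \mathrm{Alph}(u_i)\setminus\{b_i\}.$$
   Context: $\mathrm{Alph}(x)$ is the set of letters occurring in $x$; $\widetilde{x}$ is the reversal of $x$; $\epsilon$ is the empty word. A palindrome is a word equal to its reversal. A word $w$ is rich if it has exactly $|w|+1$ distinct palindromic factors, counting the empty word. A word is square-free if it has no factor $uu$ with $u$ non-empty. -}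

module Defs where

open import Data.Nat using (ℕ; suc; _≤_)
open import Data.List using (List; []; _∷_; _++_; reverse; length; filter; inits; tails; concatMap; deduplicate)
open import Data.List.Properties using (≡-dec)
open import Data.Product using (Σ; ∃; _×_)
open import Relation.Nullary using (¬_)
open import Relation.Binary.Definitions using (DecidableEquality)
open import Relation.Binary.PropositionalEquality using (_≡_; _≢_)

module _ {A : Set} (_≟_ : DecidableEquality A) where

  IsPalindrome : List A → Set
  IsPalindrome x = x ≡ reverse x

  factors : List A → List (List A)
  factors w = concatMap inits (tails w)

  palFactors : List A → List (List A)
  palFactors w =
    deduplicate (≡-dec _≟_) (filter (λ x → ≡-dec _≟_ x (reverse x)) (factors w))

  -- w is rich: exactly |w| + 1 distinct palindromic factors (counting ε)
  Rich : List A → Set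
  Rich w = length (palFactors w) ≡ suc (length w)

SquareFree : {A : Set} → List A → Set
SquareFree {A} w =
  ¬ (Σ (List A) λ x → Σ (List A) λ u → Σ (List A) λ y →
       (u ≢ []) × (w ≡ x ++ (u ++ u) ++ y))

module Submission where

-- Richness yields the key tool: every complete return x g x (x ∉ g) in w has a palindromic
-- interior g, since x g x has a palindromic factor beyond those of x g, which can only be
-- x g x itself, and richness passes to factors.  With square-freeness such interiors are
-- odd palindromes, and no x g x g̃ occurs.  For a return spanning several blocks,
-- t a v₁ a ⋯ a vₙ a z, palindromicity compares the a-separated pieces: t = z̃ and the
-- blocks are mirror-symmetric.

open import Defs
open import Data.Nat using (ℕ; zero; suc; _≤_; _<_; _+_; z≤n; s≤s)
open import Data.Nat.Properties using (module ≤-Reasoning; ≤-refl; ≤-trans; ≤-pred; ≤-reflexive; <⇒≤; <⇒≱; n≤1+n; m≤n+m; +-suc; +-assoc; +-comm; +-identityʳ; m≤n⇒∃[o]m+o≡n)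
open import Data.Nat.Induction using (<-rec)
open import Data.List using (List; []; _∷_; _++_; reverse; length; map; filter; inits; tails; intercalate; applyUpTo; _∷ʳ_; initLast; _∷ʳ′_)
open import Data.List.Properties using (≡-dec; ++-assoc; ++-identityʳ; ++-monoid; reverse-++; reverse-involutive; reverse-injective; unfold-reverse; map-++; ∷-injective; ∷-injectiveˡ; ∷-injectiveʳ; ∷ʳ-injective; ∷ʳ-injectiveˡ)
open import Data.List.Membership.Propositional using (_∈_; _∉_)
open import Data.List.Membership.Propositional.Properties using (∈-map⁺; ∈-map⁻; ∈-concat⁺′; ∈-concat⁻′; ∈-filter⁺; ∈-filter⁻; ∈-deduplicate⁺; ∈-deduplicate⁻; ∈-∃++; ∈-++⁻; ∈-++⁺ˡ; ∈-++⁺ʳ)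
import Data.List.Membership.DecPropositional as DecMembership
open import Data.List.Relation.Binary.Subset.Propositional using (_⊆_)
open import Data.List.Relation.Unary.Any using (here; there)
open import Data.List.Relation.Unary.Any.Properties using (reverse⁺; reverse⁻)
open import Data.List.Relation.Unary.All as All using (All; []; _∷_)
open import Data.List.Relation.Unary.All.Properties using (∷ʳ⁺)
open import Data.List.Relation.Unary.AllPairs using (_∷_)
open import Data.List.Relation.Unary.Unique.Propositional using (Unique)
import Data.List.Relation.Unary.Unique.DecPropositional.Properties as UniqueDec
open import Data.Product using (Σ; _×_; _,_; proj₁; proj₂)
open import Data.Sum using (_⊎_; inj₁; inj₂)
open import Data.Empty using (⊥; ⊥-elim)
open import Function using (_∘_)
open import Function.Bundles using (_⇔_; Equivalence)
open import Relation.Nullary using (¬_; yes; no)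
open import Relation.Binary.Definitions using (DecidableEquality)
open import Relation.Binary.PropositionalEquality using (_≡_; _≢_; refl; sym; trans; cong; cong₂; subst; module ≡-Reasoning)
import Algebra.Solver.Monoid as MonoidSolver

module _ {B : Set} where

  Factor : List B → List B → Set
  Factor z w = Σ (List B) λ p → Σ (List B) λ s → w ≡ p ++ z ++ s

  factor-within : ∀ {y z w} p s → y ≡ p ++ z ++ s → Factor y w → Factor z w
  factor-within {z = z} p s refl (p′ , s′ , refl) =
    p′ ++ p , s ++ s′ ,
    solve 5 (λ p′ p z s s′ → p′ ⊕ ((p ⊕ (z ⊕ s)) ⊕ s′) ⊜ (p′ ⊕ p) ⊕ (z ⊕ (s ⊕ s′))) refl p′ p z s s′
    where open MonoidSolver (++-monoid B) using (solve; _⊕_; _⊜_)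

  ∈-factor : ∀ {x : B} {z w} → x ∈ z → Factor z w → x ∈ w
  ∈-factor x∈ (p , s , refl) = ∈-++⁺ʳ p (∈-++⁺ˡ x∈)

  ++-∷-nonempty : ∀ p {x : B} {q} → p ++ x ∷ q ≢ []
  ++-∷-nonempty [] ()
  ++-∷-nonempty (_ ∷ _) ()

  length-∷ʳ : ∀ (g : List B) {d} → length (g ∷ʳ d) ≡ suc (length g)
  length-∷ʳ [] = refl
  length-∷ʳ (_ ∷ g) = cong suc (length-∷ʳ g)

  reverse-mid : ∀ p (x : B) q → reverse (p ++ x ∷ q) ≡ reverse q ++ x ∷ reverse p
  reverse-mid p x q = begin
    reverse (p ++ x ∷ q)            ≡⟨ reverse-++ p (x ∷ q) ⟩
    reverse (x ∷ q) ++ reverse p    ≡⟨ cong (_++ reverse p) (unfold-reverse x q) ⟩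
    (reverse q ∷ʳ x) ++ reverse p   ≡⟨ ++-assoc (reverse q) (x ∷ []) (reverse p) ⟩
    reverse q ++ x ∷ reverse p      ∎
    where open ≡-Reasoning

  odd-palindrome : ∀ v (b : B) → reverse (v ++ b ∷ reverse v) ≡ v ++ b ∷ reverse v
  odd-palindrome v b = trans (reverse-mid v b (reverse v)) (cong (_++ b ∷ reverse v) (reverse-involutive v))

  separated : ∀ {x : B} p {q p′ q′} → x ∉ p → x ∉ p′ → p ++ x ∷ q ≡ p′ ++ x ∷ q′ → p ≡ p′ × q ≡ q′
  separated [] {p′ = []} _ _ eq = refl , ∷-injectiveʳ eq
  separated [] {p′ = _ ∷ _} _ x∉p′ eq = ⊥-elim (x∉p′ (here (∷-injectiveˡ eq)))
  separated (_ ∷ _) {p′ = []} x∉p _ eq = ⊥-elim (x∉p (here (sym (∷-injectiveˡ eq))))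
  separated (y ∷ p) {p′ = y′ ∷ p′} x∉p x∉p′ eq with ∷-injective eq
  ... | refl , eq′ with separated p (λ m → x∉p (there m)) (λ m → x∉p′ (there m)) eq′
  ... | refl , q≡q′ = refl , q≡q′

  suffix-after : ∀ s {x : B} {t s′ r} → s ++ x ∷ t ≡ s′ ++ r → x ∉ r → Σ (List B) λ m → t ≡ m ++ r
  suffix-after [] {s′ = []} eq x∉r = ⊥-elim (x∉r (subst (_ ∈_) eq (here refl)))
  suffix-after [] {s′ = _ ∷ s′} eq _ = s′ , ∷-injectiveʳ eq
  suffix-after (_ ∷ s) {x} {s′ = []} eq x∉r = ⊥-elim (x∉r (subst (x ∈_) eq (there (∈-++⁺ʳ s (here refl)))))
  suffix-after (_ ∷ s) {s′ = _ ∷ s′} eq x∉r = suffix-after s (∷-injectiveʳ eq) x∉r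

  palindrome-interior : ∀ (c : B) g d → c ∷ g ∷ʳ d ≡ reverse (c ∷ g ∷ʳ d) → c ≡ d × g ≡ reverse g
  palindrome-interior c g d pal
    with ∷-injective (trans pal (trans (unfold-reverse c (g ∷ʳ d)) (cong (_∷ʳ c) (reverse-++ g (d ∷ [])))))
  ... | c≡d , g∷ʳd≡ = c≡d , ∷ʳ-injectiveˡ g (reverse g) g∷ʳd≡

  suffixes-comparable : ∀ p {z p′ z′ : List B} → p ++ z ≡ p′ ++ z′ →
    (Σ (List B) λ m → z′ ≡ m ++ z) ⊎ (Σ (List B) λ m → z ≡ m ++ z′)
  suffixes-comparable [] {p′ = p′} eq = inj₂ (p′ , eq)
  suffixes-comparable (x ∷ p) {p′ = []} eq = inj₁ (x ∷ p , sym eq)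
  suffixes-comparable (_ ∷ p) {p′ = _ ∷ _} eq = suffixes-comparable p (∷-injectiveʳ eq)

  palindrome-shape : ∀ (g : List B) → g ≡ reverse g →
    (Σ (List B) λ q → g ≡ q ++ reverse q) ⊎ (Σ (List B) λ q → Σ B λ c → g ≡ q ++ c ∷ reverse q)
  palindrome-shape g = shape (length g) g ≤-refl
    where
    wrap : ∀ c q m → c ∷ (q ++ m ++ reverse q) ∷ʳ c ≡ (c ∷ q) ++ m ++ reverse (c ∷ q)
    wrap c q m = cong (c ∷_) (begin
      (q ++ m ++ reverse q) ++ c ∷ []   ≡⟨ ++-assoc q (m ++ reverse q) (c ∷ []) ⟩
      q ++ (m ++ reverse q) ++ c ∷ []   ≡⟨ cong (q ++_) (++-assoc m (reverse q) (c ∷ [])) ⟩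
      q ++ m ++ reverse q ∷ʳ c          ≡⟨ cong (λ r → q ++ m ++ r) (unfold-reverse c q) ⟨
      q ++ m ++ reverse (c ∷ q)         ∎)
      where open ≡-Reasoning

    shape : ∀ n g → length g ≤ n → g ≡ reverse g →
      (Σ (List B) λ q → g ≡ q ++ reverse q) ⊎ (Σ (List B) λ q → Σ B λ c → g ≡ q ++ c ∷ reverse q)
    shape _ [] _ _ = inj₁ ([] , refl)
    shape n (c ∷ g) _ _ with initLast g
    shape n (c ∷ .[]) _ _ | [] = inj₂ ([] , c , refl)
    shape (suc n) (c ∷ .(g ∷ʳ d)) (s≤s len) pal | g ∷ʳ′ d with palindrome-interior c g d pal
    ... | refl , inner with shape n g (≤-trans (n≤1+n _) (subst (_≤ n) (length-∷ʳ g) len)) inner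
    ...   | inj₁ (q , g≡) = inj₁ (c ∷ q , trans (cong (λ g → c ∷ g ∷ʳ c) g≡) (wrap c q []))
    ...   | inj₂ (q , m , g≡) = inj₂ (c ∷ q , m , trans (cong (λ g → c ∷ g ∷ʳ c) g≡) (wrap c q (m ∷ [])))

  palindrome-centre : ∀ v {b : B} {v′ b′} → v ++ b ∷ reverse v ≡ v′ ++ b′ ∷ reverse v′ → b ≡ b′
  palindrome-centre [] {v′ = []} eq = ∷-injectiveˡ eq
  palindrome-centre [] {v′ = x′ ∷ v′} eq = ⊥-elim (++-∷-nonempty v′ (sym (∷-injectiveʳ eq)))
  palindrome-centre (x ∷ v) {v′ = []} eq = ⊥-elim (++-∷-nonempty v (∷-injectiveʳ eq))
  palindrome-centre (x ∷ v) {b} {x′ ∷ v′} {b′} eq =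
    palindrome-centre v (∷ʳ-injectiveˡ (v ++ b ∷ reverse v) (v′ ++ b′ ∷ reverse v′)
      (trans (snoc v b x) (trans (∷-injectiveʳ eq) (sym (snoc v′ b′ x′)))))
    where
    snoc : ∀ v (b x : B) → (v ++ b ∷ reverse v) ∷ʳ x ≡ v ++ b ∷ reverse (x ∷ v)
    snoc v b x = trans (++-assoc v (b ∷ reverse v) (x ∷ [])) (cong (λ r → v ++ b ∷ r) (sym (unfold-reverse x v)))

  ∉-reverse⁺ : ∀ {x : B} {l} → x ∉ l → x ∉ reverse l
  ∉-reverse⁺ x∉l m = x∉l (reverse⁻ m)

  module _ (_≟_ : DecidableEquality B) where
    open DecMembership _≟_ using (_∈?_)

    first-split : ∀ {x} l → x ∈ l → Σ (List B) λ p → Σ (List B) λ q → (l ≡ p ++ x ∷ q) × (x ∉ p)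
    first-split {x} (y ∷ l) m with x ≟ y
    ... | yes refl = [] , l , refl , λ ()
    first-split {x} (y ∷ l) (here x≡y) | no x≢y = ⊥-elim (x≢y x≡y)
    first-split {x} (y ∷ l) (there m) | no x≢y with first-split l m
    ... | p , q , refl , x∉p = y ∷ p , q , refl , λ { (here x≡y) → x≢y x≡y ; (there m′) → x∉p m′ }

    last-split : ∀ {x} l → x ∈ l → Σ (List B) λ p → Σ (List B) λ q → (l ≡ p ++ x ∷ q) × (x ∉ q)
    last-split {x} l m with first-split (reverse l) (reverse⁺ m)
    ... | p , q , rl≡ , x∉p = reverse q , reverse p ,
          trans (sym (reverse-involutive l)) (trans (cong reverse rl≡) (reverse-mid p x q)) , ∉-reverse⁺ x∉p

    ⊆-or-escape : ∀ xs ys → (xs ⊆ ys) ⊎ (Σ B λ z → z ∈ xs × z ∉ ys)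
    ⊆-or-escape [] ys = inj₁ λ ()
    ⊆-or-escape (x ∷ xs) ys with x ∈? ys | ⊆-or-escape xs ys
    ... | no x∉ys | _ = inj₂ (x , here refl , x∉ys)
    ... | yes _ | inj₂ (z , z∈ , z∉) = inj₂ (z , there z∈ , z∉)
    ... | yes x∈ys | inj₁ xs⊆ys = inj₁ λ { (here refl) → x∈ys ; (there m) → xs⊆ys m }

  private
    remove : ∀ (ys₁ : List B) {x z ys₂} → z ∈ ys₁ ++ x ∷ ys₂ → x ≢ z → z ∈ ys₁ ++ ys₂
    remove [] (here refl) x≢z = ⊥-elim (x≢z refl)
    remove [] (there m) _ = m
    remove (y ∷ ys₁) (here refl) _ = here refl
    remove (y ∷ ys₁) (there m) x≢z = there (remove ys₁ m x≢z)

    length-remove : ∀ (ys₁ : List B) {x ys₂} → length (ys₁ ++ x ∷ ys₂) ≡ suc (length (ys₁ ++ ys₂))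
    length-remove [] = refl
    length-remove (_ ∷ ys₁) = cong suc (length-remove ys₁)

  unique-length : ∀ {xs ys : List B} → Unique xs → xs ⊆ ys → length xs ≤ length ys
  unique-length {[]} _ _ = z≤n
  unique-length {x ∷ xs} (x∉xs ∷ uxs) sub with ∈-∃++ (sub (here refl))
  ... | ys₁ , ys₂ , refl = subst (suc (length xs) ≤_) (sym (length-remove ys₁))
        (s≤s (unique-length uxs (λ z∈ → remove ys₁ (sub (there z∈)) (All.lookup x∉xs z∈))))

  module _ (_≟_ : DecidableEquality B) where

    one-escape-length : ∀ {xs ys : List B} → Unique xs →
      (∀ {z z′} → z ∈ xs → z′ ∈ xs → z ∉ ys → z′ ∉ ys → z ≡ z′) → length xs ≤ suc (length ys)
    one-escape-length {xs} {ys} uxs at-most-one with ⊆-or-escape _≟_ xs ys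
    ... | inj₁ xs⊆ys = ≤-trans (unique-length uxs xs⊆ys) (n≤1+n _)
    ... | inj₂ (z , z∈ , z∉) = unique-length uxs into
      where
      open DecMembership _≟_ using (_∈?_)
      into : xs ⊆ z ∷ ys
      into {y} y∈ with y ∈? ys
      ... | yes y∈ys = there y∈ys
      ... | no y∉ys = here (at-most-one y∈ z∈ y∉ys z∉)

    escape : ∀ {xs ys : List B} → Unique xs → length ys < length xs → Σ B λ z → z ∈ xs × z ∉ ys
    escape {xs} {ys} uxs longer with ⊆-or-escape _≟_ xs ys
    ... | inj₁ xs⊆ys = ⊥-elim (<⇒≱ longer (unique-length uxs xs⊆ys))
    ... | inj₂ found = found

-- Palindromic factors and the complete-return property of rich words
module RichWords {A : Set} (_≟_ : DecidableEquality A) where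

  private
    palindrome? = λ (x : List A) → ≡-dec _≟_ x (reverse x)

    inits⁺ : ∀ (z s : List A) → z ∈ inits (z ++ s)
    inits⁺ [] s = here refl
    inits⁺ (x ∷ z) s = there (∈-map⁺ (x ∷_) (inits⁺ z s))

    inits⁻ : ∀ xs {z} → z ∈ inits xs → Σ (List A) λ s → xs ≡ z ++ s
    inits⁻ [] (here refl) = [] , refl
    inits⁻ (x ∷ xs) (here refl) = x ∷ xs , refl
    inits⁻ (x ∷ xs) (there m) with ∈-map⁻ (x ∷_) {xs = inits xs} m
    ... | z′ , m′ , refl with inits⁻ xs m′
    ... | s , refl = s , refl

    tails⁺ : ∀ (p z : List A) → z ∈ tails (p ++ z)
    tails⁺ [] [] = here refl
    tails⁺ [] (x ∷ z) = here refl
    tails⁺ (x ∷ p) z = there (tails⁺ p z)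

    tails⁻ : ∀ xs {z} → z ∈ tails xs → Σ (List A) λ p → xs ≡ p ++ z
    tails⁻ [] (here refl) = [] , refl
    tails⁻ (x ∷ xs) (here refl) = [] , refl
    tails⁻ (x ∷ xs) (there m) with tails⁻ xs m
    ... | p , refl = x ∷ p , refl

  palFactor⁺ : ∀ {z w} → z ≡ reverse z → Factor z w → z ∈ palFactors _≟_ w
  palFactor⁺ {z} pal (p , s , refl) =
    ∈-deduplicate⁺ (≡-dec _≟_)
      (∈-filter⁺ palindrome? (∈-concat⁺′ (inits⁺ z s) (∈-map⁺ inits (tails⁺ p (z ++ s)))) pal)

  palFactor⁻ : ∀ {z} w → z ∈ palFactors _≟_ w → (z ≡ reverse z) × Factor z w
  palFactor⁻ w m with ∈-filter⁻ palindrome? (∈-deduplicate⁻ (≡-dec _≟_) _ m)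
  ... | m′ , pal with ∈-concat⁻′ (map inits (tails w)) m′
  ... | xs , z∈xs , xs∈ with ∈-map⁻ inits {xs = tails w} xs∈
  ... | t , t∈ , refl with tails⁻ w t∈ | inits⁻ t z∈xs
  ... | p , refl | s , refl = pal , p , s , refl

  palFactors-unique : ∀ w → Unique (palFactors _≟_ w)
  palFactors-unique w = UniqueDec.deduplicate-! (≡-dec _≟_) (filter palindrome? (factors _≟_ w))

  #pal : List A → ℕ
  #pal w = length (palFactors _≟_ w)

  #pal-mono : ∀ {v w} → (∀ {z} → z ≡ reverse z → Factor z v → Factor z w) → #pal v ≤ #pal w
  #pal-mono {v} inclusion = unique-length (palFactors-unique v)
    λ m → let pal , occ = palFactor⁻ v m in palFactor⁺ pal (inclusion pal occ)

  #pal-reverse : ∀ w → #pal (reverse w) ≤ #pal w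
  #pal-reverse w = #pal-mono mirrored
    where
    mirrored : ∀ {z} → z ≡ reverse z → Factor z (reverse w) → Factor z w
    mirrored {z} pal (p , s , eq) = reverse s , reverse p , (begin
      w                                       ≡⟨ reverse-involutive w ⟨
      reverse (reverse w)                     ≡⟨ cong reverse eq ⟩
      reverse (p ++ z ++ s)                   ≡⟨ reverse-++ p (z ++ s) ⟩
      reverse (z ++ s) ++ reverse p           ≡⟨ cong (_++ reverse p) (reverse-++ z s) ⟩
      (reverse s ++ reverse z) ++ reverse p   ≡⟨ ++-assoc (reverse s) (reverse z) (reverse p) ⟩
      reverse s ++ reverse z ++ reverse p     ≡⟨ cong (λ r → reverse s ++ r ++ reverse p) pal ⟨
      reverse s ++ z ++ reverse p             ∎)
      where open ≡-Reasoning

  new-is-suffix : ∀ {z} w c → z ∉ palFactors _≟_ w → z ≡ reverse z → Factor z (w ∷ʳ c) →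
    Σ (List A) λ p → w ∷ʳ c ≡ p ++ z
  new-is-suffix {z} w c new pal (p , s , eq) with initLast s
  ... | [] = p , trans eq (cong (p ++_) (++-identityʳ z))
  ... | s′ ∷ʳ′ d = ⊥-elim (new (palFactor⁺ pal (p , s′ , ∷ʳ-injectiveˡ w (p ++ z ++ s′) (begin
    w ∷ʳ c                  ≡⟨ eq ⟩
    p ++ z ++ s′ ∷ʳ d       ≡⟨ cong (p ++_) (++-assoc z s′ (d ∷ [])) ⟨
    p ++ (z ++ s′) ∷ʳ d     ≡⟨ ++-assoc p (z ++ s′) (d ∷ []) ⟨
    (p ++ z ++ s′) ∷ʳ d     ∎))))
    where open ≡-Reasoning

  -- a palindromic suffix z′ of a longer palindromic suffix z of w c is also a prefix
  -- of z, hence it already occurs in w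
  inner-suffix-occurs : ∀ {z z′ m p} w c x → z ≡ reverse z → z′ ≡ reverse z′ →
    z ≡ (x ∷ m) ++ z′ → w ∷ʳ c ≡ p ++ z → Factor z′ w
  inner-suffix-occurs {z} {z′} {m} {p} w c x pal pal′ z≡ w∷ʳc≡ =
    p , reverse m , ∷ʳ-injectiveˡ w (p ++ z′ ++ reverse m) (begin
      w ∷ʳ c                        ≡⟨ w∷ʳc≡ ⟩
      p ++ z                        ≡⟨ cong (p ++_) z-mirrored ⟩
      p ++ z′ ++ reverse (x ∷ m)    ≡⟨ cong (λ r → p ++ z′ ++ r) (unfold-reverse x m) ⟩
      p ++ z′ ++ reverse m ∷ʳ x
        ≡⟨ solve 4 (λ p z′ r x → p ⊕ (z′ ⊕ (r ⊕ x)) ⊜ (p ⊕ (z′ ⊕ r)) ⊕ x) refl p z′ (reverse m) (x ∷ []) ⟩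
      (p ++ z′ ++ reverse m) ∷ʳ x   ∎)
    where
    open ≡-Reasoning
    open MonoidSolver (++-monoid A) using (solve; _⊕_; _⊜_)
    z-mirrored : z ≡ z′ ++ reverse (x ∷ m)
    z-mirrored = trans pal (trans (cong reverse z≡) (trans (reverse-++ (x ∷ m) z′) (cong (_++ reverse (x ∷ m)) (sym pal′))))

  -- appending a letter creates at most one new palindromic factor: two new ones
  -- are both suffixes, and the shorter one would already occur in w
  #pal-snoc : ∀ w c → #pal (w ∷ʳ c) ≤ suc (#pal w)
  #pal-snoc w c = one-escape-length (≡-dec _≟_) (palFactors-unique (w ∷ʳ c)) at-most-one
    where
    at-most-one : ∀ {z z′} → z ∈ palFactors _≟_ (w ∷ʳ c) → z′ ∈ palFactors _≟_ (w ∷ʳ c) →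
      z ∉ palFactors _≟_ w → z′ ∉ palFactors _≟_ w → z ≡ z′
    at-most-one {z} {z′} z∈ z′∈ z-new z′-new with palFactor⁻ _ z∈ | palFactor⁻ _ z′∈
    ... | pal , occ | pal′ , occ′ with new-is-suffix w c z-new pal occ | new-is-suffix w c z′-new pal′ occ′
    ... | p , eq | p′ , eq′ with suffixes-comparable p {z} {p′} {z′} (trans (sym eq) eq′)
    ... | inj₁ ([] , refl) = refl
    ... | inj₁ (x ∷ _ , z′≡) = ⊥-elim (z-new (palFactor⁺ pal (inner-suffix-occurs w c x pal′ pal z′≡ eq′)))
    ... | inj₂ ([] , refl) = refl
    ... | inj₂ (x ∷ _ , z≡) = ⊥-elim (z′-new (palFactor⁺ pal′ (inner-suffix-occurs w c x pal pal′ z≡ eq)))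

  -- by reversal, the same holds for prepending a letter
  #pal-cons : ∀ c w → #pal (c ∷ w) ≤ suc (#pal w)
  #pal-cons c w = begin
    #pal (c ∷ w)                     ≡⟨ cong #pal (reverse-involutive (c ∷ w)) ⟨
    #pal (reverse (reverse (c ∷ w)))  ≤⟨ #pal-reverse (reverse (c ∷ w)) ⟩
    #pal (reverse (c ∷ w))            ≡⟨ cong #pal (unfold-reverse c w) ⟩
    #pal (reverse w ∷ʳ c)             ≤⟨ #pal-snoc (reverse w) c ⟩
    suc (#pal (reverse w))            ≤⟨ s≤s (#pal-reverse w) ⟩
    suc (#pal w)                      ∎
    where open ≤-Reasoning

  #pal-bound : ∀ w → #pal w ≤ suc (length w)
  #pal-bound [] = ≤-refl
  #pal-bound (c ∷ w) = ≤-trans (#pal-cons c w) (s≤s (#pal-bound w))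

  -- w attains the bound, i.e. w is rich
  Full : List A → Set
  Full w = suc (length w) ≤ #pal w

  full-infix : ∀ p f s → Full (p ++ f ++ s) → Full f
  full-infix (c ∷ p) f s full = full-infix p f s (≤-pred (≤-trans full (#pal-cons c (p ++ f ++ s))))
  full-infix [] f [] full = subst Full (++-identityʳ f) full
  full-infix [] f (x ∷ s) full =
    ≤-pred (≤-trans (subst (λ n → suc n ≤ #pal (f ∷ʳ x)) (length-∷ʳ f) shorter) (#pal-snoc f x))
    where
    shorter : Full (f ∷ʳ x)
    shorter = full-infix [] (f ∷ʳ x) s (subst Full (sym (++-assoc f (x ∷ []) s)) full)

  return-suffixes : ∀ {x : A} {g : List A} p z → x ∉ g → x ∷ g ∷ʳ x ≡ p ++ z → z ≡ reverse z →
    (z ≡ []) ⊎ (z ≡ x ∷ []) ⊎ (z ≡ x ∷ g ∷ʳ x)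
  return-suffixes [] z _ eq _ = inj₂ (inj₂ (sym eq))
  return-suffixes (_ ∷ _) [] _ _ _ = inj₁ refl
  return-suffixes {x} {g} (_ ∷ p) (y ∷ z) x∉g eq pal
    with ∷ʳ-injective g (p ++ reverse z) (trans (∷-injectiveʳ eq) (begin
      p ++ y ∷ z              ≡⟨ cong (p ++_) (trans pal (unfold-reverse y z)) ⟩
      p ++ reverse z ∷ʳ y     ≡⟨ ++-assoc p (reverse z) (y ∷ []) ⟨
      (p ++ reverse z) ∷ʳ y   ∎))
    where open ≡-Reasoning
  ... | g≡ , refl with reverse z | trans pal (unfold-reverse y z) | reverse-involutive z
  ... | [] | _ | z≡ = inj₂ (inj₁ (cong (y ∷_) (sym z≡)))
  ... | r ∷ rs | y∷z≡ | _ =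
    ⊥-elim (x∉g (subst (_∈ g) (sym (∷-injectiveˡ y∷z≡)) (subst (r ∈_) (sym g≡) (∈-++⁺ʳ p (here refl)))))

  -- in a rich word, the interior g of a complete return x g x is a palindrome: the
  -- palindromic factor that x g x has beyond those of x g must be x g x itself
  complete-return : ∀ {x : A} {g : List A} → x ∉ g → Full (x ∷ g ∷ʳ x) → g ≡ reverse g
  complete-return {x} {g} x∉g full = from-new (escape (≡-dec _≟_) (palFactors-unique (x ∷ g ∷ʳ x)) longer)
    where
    longer : #pal (x ∷ g) < #pal (x ∷ g ∷ʳ x)
    longer = ≤-trans (s≤s (#pal-bound (x ∷ g))) (subst (λ n → suc n ≤ #pal (x ∷ g ∷ʳ x)) (length-∷ʳ (x ∷ g)) full)

    from-new : (Σ (List A) λ z → z ∈ palFactors _≟_ (x ∷ g ∷ʳ x) × z ∉ palFactors _≟_ (x ∷ g)) → g ≡ reverse g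
    from-new (z , z∈ , z-new) with palFactor⁻ _ z∈
    ... | pal , occ with new-is-suffix (x ∷ g) x z-new pal occ
    ... | p , eq with return-suffixes {x} {g} p z x∉g eq pal
    ... | inj₁ refl = ⊥-elim (z-new (palFactor⁺ refl ([] , x ∷ g , refl)))
    ... | inj₂ (inj₁ refl) = ⊥-elim (z-new (palFactor⁺ refl ([] , g , refl)))
    ... | inj₂ (inj₂ refl) = proj₂ (palindrome-interior x g x pal)

  rich-returns : ∀ {w : List A} {x : A} {g : List A} →
    Rich _≟_ w → x ∉ g → Factor (x ∷ g ++ x ∷ []) w → g ≡ reverse g
  rich-returns rich x∉g (p , s , refl) = complete-return x∉g (full-infix p _ s (≤-reflexive (sym rich)))

-- Words cut into pieces by a separator letter a
module Framing {A : Set} (a : A) where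

  -- frame t [v₁, …, vₙ] z is the word t a v₁ a ⋯ a vₙ a z
  frame : List A → List (List A) → List A → List A
  frame t [] z = t ++ a ∷ z
  frame t (v ∷ vs) z = t ++ a ∷ frame v vs z

  mirror : List (List A) → List (List A)
  mirror vs = reverse (map reverse vs)

  mirror-∷ʳ : ∀ vs v → mirror (vs ∷ʳ v) ≡ reverse v ∷ mirror vs
  mirror-∷ʳ vs v = trans (cong reverse (map-++ reverse vs (v ∷ []))) (reverse-++ (map reverse vs) (reverse v ∷ []))

  frame-left : ∀ s t vs z → frame (s ++ t) vs z ≡ s ++ frame t vs z
  frame-left s t [] z = ++-assoc s t (a ∷ z)
  frame-left s t (v ∷ vs) z = ++-assoc s t (a ∷ frame v vs z)

  frame-right : ∀ t vs z z₂ → frame t vs (z ++ z₂) ≡ frame t vs z ++ z₂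
  frame-right t [] z z₂ = sym (++-assoc t (a ∷ z) z₂)
  frame-right t (v ∷ vs) z z₂ =
    trans (cong (λ r → t ++ a ∷ r) (frame-right v vs z z₂)) (sym (++-assoc t (a ∷ frame v vs z) z₂))

  frame-∷ʳ : ∀ t vs v z → frame t (vs ∷ʳ v) z ≡ frame t vs v ++ a ∷ z
  frame-∷ʳ t [] v z = sym (++-assoc t (a ∷ v) (a ∷ z))
  frame-∷ʳ t (u ∷ vs) v z =
    trans (cong (λ r → t ++ a ∷ r) (frame-∷ʳ u vs v z)) (sym (++-assoc t (a ∷ frame u vs v) (a ∷ z)))

  frame-return : ∀ s x t vs z z₂ → frame (s ++ x ∷ t) vs (z ++ x ∷ z₂) ≡ s ++ (x ∷ frame t vs z ++ x ∷ []) ++ z₂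
  frame-return s x t vs z z₂ = begin
    frame (s ++ x ∷ t) vs (z ++ x ∷ z₂)          ≡⟨ frame-left s (x ∷ t) vs (z ++ x ∷ z₂) ⟩
    s ++ frame (x ∷ t) vs (z ++ x ∷ z₂)          ≡⟨ cong (s ++_) (frame-left (x ∷ []) t vs (z ++ x ∷ z₂)) ⟩
    s ++ x ∷ frame t vs (z ++ x ∷ z₂)            ≡⟨ cong (λ r → s ++ x ∷ frame t vs r) (++-assoc z (x ∷ []) z₂) ⟨
    s ++ x ∷ frame t vs ((z ∷ʳ x) ++ z₂)         ≡⟨ cong (λ r → s ++ x ∷ r) (frame-right t vs (z ∷ʳ x) z₂) ⟩
    s ++ x ∷ frame t vs (z ∷ʳ x) ++ z₂           ≡⟨ cong (λ r → s ++ x ∷ r ++ z₂) (frame-right t vs z (x ∷ [])) ⟩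
    s ++ (x ∷ frame t vs z ++ x ∷ []) ++ z₂      ∎
    where open ≡-Reasoning

  frame-reverse : ∀ t vs z → reverse (frame t vs z) ≡ frame (reverse z) (mirror vs) (reverse t)
  frame-reverse t [] z = reverse-mid t a z
  frame-reverse t (v ∷ vs) z = begin
    reverse (t ++ a ∷ frame v vs z)                              ≡⟨ reverse-mid t a (frame v vs z) ⟩
    reverse (frame v vs z) ++ a ∷ reverse t                      ≡⟨ cong (_++ a ∷ reverse t) (frame-reverse v vs z) ⟩
    frame (reverse z) (mirror vs) (reverse v) ++ a ∷ reverse t   ≡⟨ frame-∷ʳ (reverse z) (mirror vs) (reverse v) (reverse t) ⟨
    frame (reverse z) (mirror vs ∷ʳ reverse v) (reverse t)
      ≡⟨ cong (λ ws → frame (reverse z) ws (reverse t)) (unfold-reverse (reverse v) (map reverse vs)) ⟨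
    frame (reverse z) (mirror (v ∷ vs)) (reverse t)              ∎
    where open ≡-Reasoning

  a∈frame : ∀ t vs z → a ∈ frame t vs z
  a∈frame t [] z = ∈-++⁺ʳ t (here refl)
  a∈frame t (v ∷ vs) z = ∈-++⁺ʳ t (here refl)

  frame-∉ : ∀ {x t vs z} → x ≢ a → x ∉ t → All (x ∉_) vs → x ∉ z → x ∉ frame t vs z
  frame-∉ {t = t} {[]} x≢a x∉t _ x∉z m with ∈-++⁻ t m
  ... | inj₁ x∈t = x∉t x∈t
  ... | inj₂ (here x≡a) = x≢a x≡a
  ... | inj₂ (there x∈z) = x∉z x∈z
  frame-∉ {t = t} {v ∷ vs} x≢a x∉t (x∉v ∷ x∉vs) x∉z m with ∈-++⁻ t m
  ... | inj₁ x∈t = x∉t x∈t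
  ... | inj₂ (here x≡a) = x≢a x≡a
  ... | inj₂ (there x∈) = frame-∉ x≢a x∉v x∉vs x∉z x∈

  frame-injective : ∀ {t vs z t′ vs′ z′} → a ∉ t → All (a ∉_) vs → a ∉ z →
    a ∉ t′ → All (a ∉_) vs′ → a ∉ z′ →
    frame t vs z ≡ frame t′ vs′ z′ → t ≡ t′ × vs ≡ vs′ × z ≡ z′
  frame-injective {t} {[]} {vs′ = []} a∉t _ _ a∉t′ _ _ eq with separated t a∉t a∉t′ eq
  ... | t≡ , z≡ = t≡ , refl , z≡
  frame-injective {t} {[]} {vs′ = v′ ∷ vs′} {z′} a∉t _ a∉z a∉t′ _ _ eq with separated t a∉t a∉t′ eq
  ... | _ , z≡ = ⊥-elim (a∉z (subst (a ∈_) (sym z≡) (a∈frame v′ vs′ z′)))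
  frame-injective {t} {v ∷ vs} {z} {vs′ = []} a∉t _ _ a∉t′ _ a∉z′ eq with separated t a∉t a∉t′ eq
  ... | _ , z≡ = ⊥-elim (a∉z′ (subst (a ∈_) z≡ (a∈frame v vs z)))
  frame-injective {t} {v ∷ vs} {vs′ = v′ ∷ vs′} a∉t (a∉v ∷ a∉vs) a∉z a∉t′ (a∉v′ ∷ a∉vs′) a∉z′ eq
    with separated t a∉t a∉t′ eq
  ... | t≡ , rest with frame-injective a∉v a∉vs a∉z a∉v′ a∉vs′ a∉z′ rest
  ...   | v≡ , vs≡ , z≡ = t≡ , cong₂ _∷_ v≡ vs≡ , z≡

  frame-palindrome : ∀ {t vs z} → a ∉ t → All (a ∉_) vs → a ∉ z →
    frame t vs z ≡ reverse (frame t vs z) → t ≡ reverse z × vs ≡ mirror vs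
  frame-palindrome {t} {vs} {z} a∉t a∉vs a∉z pal
    with frame-injective a∉t a∉vs a∉z (∉-reverse⁺ a∉z) mirror-free (∉-reverse⁺ a∉t)
                         (trans pal (frame-reverse t vs z))
    where
    mirror-free : All (a ∉_) (mirror vs)
    mirror-free = All.tabulate λ m → reversed-free (∈-map⁻ reverse (reverse⁻ m))
      where
      reversed-free : ∀ {u} → (Σ (List A) λ v → v ∈ vs × u ≡ reverse v) → a ∉ u
      reversed-free (v , v∈ , refl) = ∉-reverse⁺ (All.lookup a∉vs v∈)
  ... | t≡ , vs≡ , _ = t≡ , vs≡

-- Consecutive blocks of a sequence u of words, joined by a
module Blocks {A : Set} (a : A) (u : ℕ → List A) where

  open Framing a

  -- window p n = [u p, u (p + 1), …, u (p + n - 1)], n consecutive blocks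
  window : ℕ → ℕ → List (List A)
  window p zero = []
  window p (suc n) = u p ∷ window (suc p) n

  window-∷ʳ : ∀ p n → window p (suc n) ≡ window p n ∷ʳ u (n + p)
  window-∷ʳ p zero = refl
  window-∷ʳ p (suc n) =
    cong (u p ∷_) (trans (window-∷ʳ (suc p) n) (cong (λ i → window (suc p) n ∷ʳ u i) (+-suc n p)))

  window-++ : ∀ p m n → window p (m + n) ≡ window p m ++ window (p + m) n
  window-++ p zero n = cong (λ i → window i n) (sym (+-identityʳ p))
  window-++ p (suc m) n =
    cong (u p ∷_) (trans (window-++ (suc p) m n) (cong (λ i → window (suc p) m ++ window i n) (sym (+-suc p m))))

  -- the block list u 1, …, u k of the statement is a window
  window-applyUpTo : ∀ (f : ℕ → List A) p n → (∀ j → f j ≡ u (j + p)) → applyUpTo f n ≡ window p n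
  window-applyUpTo f p zero _ = refl
  window-applyUpTo f p (suc n) f≡ =
    cong₂ _∷_ (f≡ 0) (window-applyUpTo (f ∘ suc) (suc p) n λ j → trans (f≡ (suc j)) (cong u (sym (+-suc j p))))

  window-All : ∀ {P : List A → Set} p n → (∀ i → p ≤ i → i < n + p → P (u i)) → All P (window p n)
  window-All p zero _ = []
  window-All {P} p (suc n) all = all p ≤-refl (s≤s (m≤n+m p n)) ∷ window-All (suc p) n later
    where
    later : ∀ i → suc p ≤ i → i < n + suc p → P (u i)
    later i p<i i< = all i (<⇒≤ p<i) (subst (i <_) (+-suc n p) i<)

  window-mirror : ∀ p d →
    mirror (window p (suc (suc d))) ≡ reverse (u (suc d + p)) ∷ reverse (u (d + p)) ∷ mirror (window p d)
  window-mirror p d = begin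
    mirror (window p (suc (suc d)))                             ≡⟨ cong mirror (window-∷ʳ p (suc d)) ⟩
    mirror (window p (suc d) ∷ʳ u (suc d + p))                  ≡⟨ mirror-∷ʳ (window p (suc d)) (u (suc d + p)) ⟩
    reverse (u (suc d + p)) ∷ mirror (window p (suc d))
      ≡⟨ cong (λ ws → reverse (u (suc d + p)) ∷ mirror ws) (window-∷ʳ p d) ⟩
    reverse (u (suc d + p)) ∷ mirror (window p d ∷ʳ u (d + p))
      ≡⟨ cong (reverse (u (suc d + p)) ∷_) (mirror-∷ʳ (window p d) (u (d + p))) ⟩
    reverse (u (suc d + p)) ∷ reverse (u (d + p)) ∷ mirror (window p d) ∎
    where open ≡-Reasoning

  join : List (List A) → List A
  join = intercalate (a ∷ [])

  join-frame : ∀ t vs z → join (t ∷ vs ∷ʳ z) ≡ frame t vs z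
  join-frame t [] z = refl
  join-frame t (v ∷ vs) z = cong (λ r → t ++ a ∷ r) (join-frame v vs z)

  join-prefix : ∀ S Q → Σ (List A) λ r → join (S ++ Q) ≡ join S ++ r
  join-prefix [] Q = join Q , refl
  join-prefix (s ∷ []) [] = [] , sym (++-identityʳ s)
  join-prefix (s ∷ []) (q ∷ Q) = a ∷ join (q ∷ Q) , refl
  join-prefix (s ∷ s′ ∷ S) Q with join-prefix (s′ ∷ S) Q
  ... | r , eq = r , trans (cong (λ l → s ++ a ∷ l) eq) (sym (++-assoc s (a ∷ join (s′ ∷ S)) r))

  join-suffix : ∀ P S → Σ (List A) λ l → join (P ++ S) ≡ l ++ join S
  join-suffix [] S = [] , refl
  join-suffix (p ∷ []) [] = p , sym (++-identityʳ p)
  join-suffix (p ∷ []) (s ∷ S) = p ∷ʳ a , sym (++-assoc p (a ∷ []) (join (s ∷ S)))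
  join-suffix (p ∷ p′ ∷ P) S with join-suffix (p′ ∷ P) S
  ... | l , eq = p ++ a ∷ l , trans (cong (λ r → p ++ a ∷ r) eq) (sym (++-assoc p (a ∷ l) (join S)))

  join-infix : ∀ P S Q → Factor (join S) (join (P ++ S ++ Q))
  join-infix P S Q with join-suffix P (S ++ Q) | join-prefix S Q
  ... | l , eq | r , eq′ = l , r , trans eq (cong (l ++_) eq′)

  window-factor : ∀ {p n k} → 1 ≤ p → n + p ≤ suc k → Factor (join (window p n)) (join (window 1 k))
  window-factor {suc q} {n} {k} _ bound with m≤n⇒∃[o]m+o≡n (≤-pred (subst (_≤ suc k) (+-suc n q) bound))
  ... | r , refl = subst (λ ws → Factor (join (window (suc q) n)) (join ws)) (sym blocks)
                     (join-infix (window 1 q) (window (suc q) n) (window (suc q + n) r))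
    where
    blocks : window 1 (n + q + r) ≡ window 1 q ++ window (suc q) n ++ window (suc q + n) r
    blocks = begin
      window 1 (n + q + r)                                     ≡⟨ cong (window 1) (trans (cong (_+ r) (+-comm n q)) (+-assoc q n r)) ⟩
      window 1 (q + (n + r))                                   ≡⟨ window-++ 1 q (n + r) ⟩
      window 1 q ++ window (suc q) (n + r)                     ≡⟨ cong (window 1 q ++_) (window-++ (suc q) n r) ⟩
      window 1 q ++ window (suc q) n ++ window (suc q + n) r   ∎
      where open ≡-Reasoning

  span-factor : ∀ {p n k} → 1 ≤ p → n + suc p ≤ k →
    Factor (frame (u p) (window (suc p) n) (u (n + suc p))) (join (window 1 k))
  span-factor {p} {n} {k} 1≤p bound =
    subst (λ y → Factor y (join (window 1 k))) span (window-factor 1≤p (s≤s (subst (_≤ k) (+-suc n p) bound)))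
    where
    span : join (window p (suc (suc n))) ≡ frame (u p) (window (suc p) n) (u (n + suc p))
    span = trans (cong (λ ws → join (u p ∷ ws)) (window-∷ʳ (suc p) n))
                 (join-frame (u p) (window (suc p) n) (u (n + suc p)))

-- The induction, for a word w with blocks u 1, …, u k that satisfies the consequences of
-- the hypotheses of the lemma used in the proof
module Argument {A : Set} (_≟_ : DecidableEquality A) (a : A) (u : ℕ → List A) (k : ℕ) (w : List A)
  (a-free : ∀ i → 1 ≤ i → i ≤ k → a ∉ u i)
  (alphabet : ∀ i {x} → 1 ≤ i → i ≤ k → x ∈ u i → x ∈ u 1)
  (spans : ∀ p n → 1 ≤ p → n + suc p ≤ k →
           Factor (Framing.frame a (u p) (Blocks.window a u (suc p) n) (u (n + suc p))) w)
  (returns : ∀ {x g} → x ∉ g → Factor (x ∷ g ++ x ∷ []) w → g ≡ reverse g)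
  (square-free : ∀ {U} → Factor (U ++ U) w → U ≡ [])
  where

  open Framing a
  open Blocks a u
  open DecMembership _≟_ using (_∈?_)
  open MonoidSolver (++-monoid A) using (solve; _⊕_; _⊜_)

  Occurs : List A → Set
  Occurs z = Factor z w

  private
    ∷≢[] : ∀ {x : A} {g : List A} → x ∷ g ≢ []
    ∷≢[] ()

  -- x g x g̃ with x ∉ g cannot occur: g is a palindrome, making it the square (x g)(x g)
  no-return-square : ∀ {x : A} {g} → x ∉ g → ¬ Occurs (x ∷ g ++ x ∷ reverse g)
  no-return-square {x} {g} x∉g occ = ∷≢[] (square-free {x ∷ g} (factor-within [] [] square occ))
    where
    pal : g ≡ reverse g
    pal = returns x∉g (factor-within [] (reverse g) (cong (x ∷_) (sym (++-assoc g (x ∷ []) (reverse g)))) occ)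
    square : x ∷ g ++ x ∷ reverse g ≡ [] ++ ((x ∷ g) ++ (x ∷ g)) ++ []
    square = trans (cong (λ r → x ∷ g ++ x ∷ r) (sym pal)) (sym (++-identityʳ _))

  -- the interior of a complete return is an odd palindrome v b ṽ: an even palindrome
  -- is ε, making x x a square, or has a square c c at its centre
  return-odd : ∀ {x : A} {g} → x ∉ g → Occurs (x ∷ g ++ x ∷ []) →
    Σ (List A) λ v → Σ A λ b → g ≡ v ++ b ∷ reverse v
  return-odd {x} {g} x∉g occ with palindrome-shape g (returns x∉g occ)
  ... | inj₂ odd = odd
  ... | inj₁ (q , g≡) with initLast q
  ...   | [] = ⊥-elim (∷≢[] (square-free {x ∷ []} (subst (λ g → Occurs (x ∷ g ++ x ∷ [])) g≡ occ)))
  ...   | q′ ∷ʳ′ c = ⊥-elim (∷≢[] (square-free {c ∷ []} (factor-within (x ∷ q′) (reverse q′ ++ x ∷ []) centre occ)))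
    where
    centre : x ∷ g ++ x ∷ [] ≡ (x ∷ q′) ++ ((c ∷ []) ++ (c ∷ [])) ++ reverse q′ ++ x ∷ []
    centre = begin
      x ∷ g ++ x ∷ []
        ≡⟨ cong (λ g → x ∷ g ++ x ∷ []) g≡ ⟩
      x ∷ (q′ ∷ʳ c ++ reverse (q′ ∷ʳ c)) ++ x ∷ []
        ≡⟨ cong (λ r → x ∷ (q′ ∷ʳ c ++ r) ++ x ∷ []) (reverse-++ q′ (c ∷ [])) ⟩
      x ∷ (q′ ∷ʳ c ++ c ∷ reverse q′) ++ x ∷ []
        ≡⟨ cong (x ∷_) (solve 4 (λ q c r x → ((q ⊕ c) ⊕ (c ⊕ r)) ⊕ x ⊜ q ⊕ ((c ⊕ c) ⊕ (r ⊕ x)))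
                                refl q′ (c ∷ []) (reverse q′) (x ∷ [])) ⟩
      (x ∷ q′) ++ ((c ∷ []) ++ (c ∷ [])) ++ reverse q′ ++ x ∷ []  ∎
      where open ≡-Reasoning

  -- a complete return of x across a frame y a v₁ a ⋯ a vₙ a r: if t follows the last x
  -- of y, z precedes the first x of r and x avoids the blocks vᵢ, then t a v₁ a ⋯ a vₙ a z
  -- is a palindrome, so t = z̃ and the blocks are mirror-symmetric
  return-across : ∀ {y vs r x s t z z₂} → Occurs (frame y vs r) →
    a ∉ y → All (a ∉_) vs → a ∉ r → x ≢ a → All (x ∉_) vs →
    y ≡ s ++ x ∷ t → x ∉ t → r ≡ z ++ x ∷ z₂ → x ∉ z → t ≡ reverse z × vs ≡ mirror vs
  return-across {vs = vs} {x = x} {s} {t} {z} {z₂} occ a∉y a∉vs a∉r x≢a x∉vs refl x∉t refl x∉z =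
    frame-palindrome (a∉y ∘ ∈-++⁺ʳ s ∘ there) a∉vs (a∉r ∘ ∈-++⁺ˡ)
      (returns (frame-∉ x≢a x∉t x∉vs x∉z) (factor-within s z₂ (frame-return s x t vs z z₂) occ))

  Claim : ℕ → Set
  Claim i = Σ (List A) λ v → Σ A λ b → (u i ≡ v ++ b ∷ reverse v) × (∀ x → x ∈ u (suc i) → (x ∈ u i) × (x ≢ b))

  Earlier : ℕ → Set
  Earlier h = ∀ {j} → j < suc h → 2 ≤ j → suc j ≤ k → Claim j

  -- the letters of block h + 1 occur in block h: for h = 1 by the hypothesis on the
  -- alphabet, later by the claim for block h
  block-⊆ : ∀ h → 1 ≤ h → suc (suc h) ≤ k → Earlier h → ∀ {x} → x ∈ u (suc h) → x ∈ u h
  block-⊆ (suc zero) _ top _ = alphabet 2 (s≤s z≤n) (≤-trans (n≤1+n 2) top)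
  block-⊆ (suc (suc h)) _ top earlier {x} x∈ with earlier ≤-refl (s≤s (s≤s z≤n)) (≤-trans (n≤1+n _) top)
  ... | _ , _ , _ , below = proj₁ (below x x∈)

  last-block : ∀ {x} h → x ∈ u 1 → x ∉ u (suc h) →
    Σ ℕ λ m → Σ ℕ λ d → (h ≡ d + m) × (1 ≤ m) × (x ∈ u m) × All (x ∉_) (window (suc m) (suc d))
  last-block zero x∈ x∉ = ⊥-elim (x∉ x∈)
  last-block {x} (suc h) x∈ x∉ with x ∈? u (suc h)
  ... | yes x∈h = suc h , 0 , refl , s≤s z≤n , x∈h , x∉ ∷ []
  ... | no x∉h with last-block h x∈ x∉h
  ...   | m , d , refl , 1≤m , x∈m , avoid =
          m , suc d , refl , 1≤m , x∈m ,
          subst (All (x ∉_)) (sym (window-∷ʳ (suc m) (suc d)))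
                (∷ʳ⁺ avoid (subst (λ i → x ∉ u i) (sym (cong suc (+-suc d m))) x∉))

  window-a-free : ∀ p n → 1 ≤ p → n + p ≤ suc k → All (a ∉_) (window p n)
  window-a-free p n 1≤p bound = window-All p n λ i p≤i i< → a-free i (≤-trans 1≤p p≤i) (≤-pred (≤-trans i< bound))

  module Centre (h : ℕ) (1≤h : 1 ≤ h) (top : suc (suc h) ≤ k) (v : List A) (b : A)
    (U1≡ : u (suc h) ≡ v ++ b ∷ reverse v) (U1⊆U0 : ∀ {x} → x ∈ u (suc h) → x ∈ u h) where

    a∉U0 : a ∉ u h
    a∉U0 = a-free h 1≤h (≤-trans (n≤1+n _) (≤-trans (n≤1+n _) top))

    a∉U1 : a ∉ u (suc h)
    a∉U1 = a-free (suc h) (s≤s z≤n) (≤-trans (n≤1+n _) top)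

    a∉U2 : a ∉ u (suc (suc h))
    a∉U2 = a-free (suc (suc h)) (s≤s z≤n) top

    blocks₀₁₂ : Occurs (frame (u h) (u (suc h) ∷ []) (u (suc (suc h))))
    blocks₀₁₂ = spans h 1 1≤h top

    blocks₀₁ : Occurs (frame (u h) [] (u (suc h)))
    blocks₀₁ = spans h 0 1≤h (≤-trans (n≤1+n _) top)

    blocks₁₂ : Occurs (frame (u (suc h)) [] (u (suc (suc h))))
    blocks₁₂ = spans (suc h) 0 (s≤s z≤n) top

    b∈U1 : b ∈ u (suc h)
    b∈U1 = subst (b ∈_) (sym U1≡) (∈-++⁺ʳ v (here refl))

    b≢a : b ≢ a
    b≢a refl = a∉U1 b∈U1

    -- b ∉ v: otherwise v = p b q with b ∉ q, and U1 = p b q b q̃ b p̃ contains b q b q̃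
    b∉v : b ∉ v
    b∉v b∈v with last-split _≟_ v b∈v
    ... | p , q , refl , b∉q = no-return-square b∉q (factor-within p (b ∷ reverse p) inside U1-occurs)
      where
      U1-occurs : Occurs (v ++ b ∷ reverse v)
      U1-occurs = subst Occurs U1≡ (factor-within [] (a ∷ u (suc (suc h))) refl blocks₁₂)
      inside : (p ++ b ∷ q) ++ b ∷ reverse (p ++ b ∷ q) ≡ p ++ (b ∷ q ++ b ∷ reverse q) ++ b ∷ reverse p
      inside = trans (cong (λ r → (p ++ b ∷ q) ++ b ∷ r) (reverse-mid p b q))
        (solve 5 (λ p b q r̃ p̃ → (p ⊕ (b ⊕ q)) ⊕ (b ⊕ (r̃ ⊕ (b ⊕ p̃))) ⊜ p ⊕ ((b ⊕ (q ⊕ (b ⊕ r̃))) ⊕ (b ⊕ p̃)))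
          refl p (b ∷ []) q (reverse q) (reverse p))

    -- U0 ends with b ṽ: with s b t the last b of U0, the complete return b t a v b
    -- forces t = ṽ
    U0-ends : Σ (List A) λ s → u h ≡ s ++ b ∷ reverse v
    U0-ends with last-split _≟_ (u h) (U1⊆U0 b∈U1)
    ... | s , t , U0≡ , b∉t with return-across blocks₀₁ a∉U0 [] a∉U1 b≢a [] U0≡ b∉t U1≡ b∉v
    ... | t≡ṽ , _ = s , trans U0≡ (cong (λ r → s ++ b ∷ r) t≡ṽ)

    -- b ∉ U2: the first b of U2 = z b z₂ closes the complete return b ṽ a z b, forcing
    -- z = v; then U0 a U1 a U2 contains b g b g̃ with g = ṽ a v
    b∉U2 : b ∉ u (suc (suc h))
    b∉U2 b∈U2 with first-split _≟_ _ b∈U2 | U0-ends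
    ... | z , z₂ , U2≡ , b∉z | s , U0≡
      with return-across blocks₁₂ a∉U1 [] a∉U2 b≢a [] U1≡ (∉-reverse⁺ b∉v) U2≡ b∉z
    ... | ṽ≡z̃ , _ with reverse-injective {x = v} {y = z} ṽ≡z̃
    ... | refl = no-return-square b∉g (factor-within s (b ∷ z₂) square blocks₀₁₂)
      where
      g : List A
      g = reverse v ++ a ∷ v
      b∉g : b ∉ g
      b∉g = frame-∉ b≢a (∉-reverse⁺ b∉v) [] b∉v
      g-palindrome : reverse g ≡ g
      g-palindrome = trans (reverse-mid (reverse v) a v) (cong (λ r → reverse v ++ a ∷ r) (reverse-involutive v))
      square : u h ++ a ∷ u (suc h) ++ a ∷ u (suc (suc h)) ≡ s ++ (b ∷ g ++ b ∷ reverse g) ++ b ∷ z₂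
      square = begin
        u h ++ a ∷ u (suc h) ++ a ∷ u (suc (suc h))
          ≡⟨ cong₂ (λ U0 U1 → U0 ++ a ∷ U1 ++ a ∷ u (suc (suc h))) U0≡ U1≡ ⟩
        (s ++ b ∷ reverse v) ++ a ∷ (v ++ b ∷ reverse v) ++ a ∷ u (suc (suc h))
          ≡⟨ cong (λ U2 → (s ++ b ∷ reverse v) ++ a ∷ (v ++ b ∷ reverse v) ++ a ∷ U2) U2≡ ⟩
        (s ++ b ∷ reverse v) ++ a ∷ (v ++ b ∷ reverse v) ++ a ∷ v ++ b ∷ z₂
          ≡⟨ solve 6 (λ s b ṽ a v z₂ → (s ⊕ (b ⊕ ṽ)) ⊕ (a ⊕ ((v ⊕ (b ⊕ ṽ)) ⊕ (a ⊕ (v ⊕ (b ⊕ z₂)))))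
                      ⊜ s ⊕ (((b ⊕ (ṽ ⊕ (a ⊕ v))) ⊕ (b ⊕ (ṽ ⊕ (a ⊕ v)))) ⊕ (b ⊕ z₂)))
                refl s (b ∷ []) (reverse v) (a ∷ []) v z₂ ⟩
        s ++ (b ∷ g ++ b ∷ g) ++ b ∷ z₂
          ≡⟨ cong (λ r → s ++ (b ∷ g ++ b ∷ r) ++ b ∷ z₂) g-palindrome ⟨
        s ++ (b ∷ g ++ b ∷ reverse g) ++ b ∷ z₂ ∎
        where open ≡-Reasoning

    -- a letter x of U0 ∖ U1 does not occur in U2: with s x t the last x of U0 and z x z₂
    -- the first x of U2, the complete return x t a U1 a z x forces t = z̃; since U0 ends
    -- with b ṽ ⊆ U1, t ends with b ṽ, so z starts with v b and b ∈ U2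
    near-impossible : ∀ {x} → x ∈ u h → x ∉ u (suc h) → x ∈ u (suc (suc h)) → ⊥
    near-impossible {x} x∈U0 x∉U1 x∈U2 with last-split _≟_ _ x∈U0 | first-split _≟_ _ x∈U2 | U0-ends
    ... | s , t , U0≡ , x∉t | z , z₂ , U2≡ , x∉z | s′ , U0≡′
      with return-across blocks₀₁₂ a∉U0 (a∉U1 ∷ []) a∉U2 (λ { refl → a∉U2 x∈U2 }) (x∉U1 ∷ [])
                         U0≡ x∉t U2≡ x∉z
    ... | t≡z̃ , _ with suffix-after s (trans (sym U0≡) U0≡′) (x∉U1 ∘ subst (x ∈_) (sym U1≡) ∘ ∈-++⁺ʳ v)
    ... | m , t≡ = b∉U2 (subst (b ∈_) (sym U2≡) (∈-++⁺ˡ b∈z))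
      where
      b∈z : b ∈ z
      b∈z = subst (b ∈_) (trans (cong reverse t≡z̃) (reverse-involutive z))
                  (reverse⁺ (subst (b ∈_) (sym t≡) (∈-++⁺ʳ m (here refl))))

  -- a letter x of u m that avoids u (m + 1), …, u (h + 1), where m < h, does not occur
  -- in U2 = u (h + 2): the complete return of x across u (m + 1) a ⋯ a u (h + 1) mirrors
  -- these blocks, so u (m + 1) = Ũ1 = U1 and u (m + 2) = Ũ0; by the claim for block m + 1
  -- the centre b of U1 is missing from u (m + 2), although b ∈ U0
  far-impossible : ∀ h m d {v b x} → h ≡ d + suc m → 1 ≤ m → suc (suc h) ≤ k → Earlier h →
    u (suc h) ≡ v ++ b ∷ reverse v → b ∈ u h →
    x ≢ a → x ∈ u m → All (x ∉_) (window (suc m) (suc (suc d))) → x ∈ u (suc (suc h)) → ⊥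
  far-impossible .(d + suc m) m d {v} {b} refl 1≤m top earlier U1≡ b∈U0 x≢a x∈m avoid x∈U2
    with last-split _≟_ _ x∈m | first-split _≟_ _ x∈U2
  ... | s , t , um≡ , x∉t | z , z₂ , U2≡ , x∉z
    with return-across (spans m (suc (suc d)) 1≤m top) (a-free m 1≤m m≤k)
           (window-a-free (suc m) (suc (suc d)) (s≤s z≤n) (≤-trans top (n≤1+n k)))
           (a-free _ (s≤s z≤n) top) x≢a avoid um≡ x∉t U2≡ x∉z
    where
    m≤k : m ≤ k
    m≤k = ≤-trans (≤-trans (n≤1+n m) (m≤n+m (suc m) d)) (≤-trans (n≤1+n _) (≤-trans (n≤1+n _) top))
  ... | _ , mirrored with ∷-injective (trans mirrored (window-mirror (suc m) d))
  ... | um₁≡ , rest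
    with earlier {suc m} (s≤s (m≤n+m (suc m) d)) (s≤s 1≤m)
                 (≤-trans (s≤s (s≤s (≤-trans (n≤1+n m) (m≤n+m (suc m) d)))) top)
  ... | v′ , b′ , um₁≡′ , below = proj₂ (below b b∈um₂) (palindrome-centre v (begin
      v ++ b ∷ reverse v              ≡⟨ odd-palindrome v b ⟨
      reverse (v ++ b ∷ reverse v)    ≡⟨ cong reverse U1≡ ⟨
      reverse (u (suc (d + suc m)))   ≡⟨ um₁≡ ⟨
      u (suc m)                       ≡⟨ um₁≡′ ⟩
      v′ ++ b′ ∷ reverse v′           ∎))
    where
    open ≡-Reasoning
    b∈um₂ : b ∈ u (suc (suc m))
    b∈um₂ = subst (b ∈_) (sym (∷-injectiveˡ rest)) (reverse⁺ b∈U0)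

  -- the claim for block i ≥ 2, given the claim for the earlier blocks: block i is an odd
  -- palindrome v b ṽ (a complete return of a), and a letter x of the next block lies in
  -- block i (last-block separates the near and far cases) and differs from b
  step : ∀ i → (∀ {j} → j < i → 2 ≤ j → suc j ≤ k → Claim j) → 2 ≤ i → suc i ≤ k → Claim i
  step (suc h) earlier (s≤s 1≤h) top
    with return-odd a∉U1 (factor-within (u h) (u (suc (suc h))) a-return (spans h 1 1≤h top))
    where
    a∉U1 : a ∉ u (suc h)
    a∉U1 = a-free (suc h) (s≤s z≤n) (≤-trans (n≤1+n _) top)
    a-return : frame (u h) (u (suc h) ∷ []) (u (suc (suc h))) ≡ u h ++ (a ∷ u (suc h) ++ a ∷ []) ++ u (suc (suc h))
    a-return = cong (λ r → u h ++ a ∷ r) (sym (++-assoc (u (suc h)) (a ∷ []) (u (suc (suc h)))))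
  ... | v , b , U1≡ = v , b , U1≡ , λ x x∈ → U2⊆U1 x∈ , λ { refl → b∉U2 x∈ }
    where
    U1⊆U0 : ∀ {x} → x ∈ u (suc h) → x ∈ u h
    U1⊆U0 = block-⊆ h 1≤h top earlier

    open Centre h 1≤h top v b U1≡ U1⊆U0

    U2⊆U1 : ∀ {x} → x ∈ u (suc (suc h)) → x ∈ u (suc h)
    U2⊆U1 {x} x∈ with x ∈? u (suc h)
    ... | yes x∈U1 = x∈U1
    ... | no x∉U1 with last-block h (alphabet (suc (suc h)) (s≤s z≤n) top x∈) x∉U1
    ...   | m , zero , h≡m , _ , x∈m , _ = ⊥-elim (near-impossible (subst (λ i → x ∈ u i) (sym h≡m) x∈m) x∉U1 x∈)
    ...   | m , suc d , h≡ , 1≤m , x∈m , avoid =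
            ⊥-elim (far-impossible h m d (trans h≡ (sym (+-suc d m))) 1≤m top earlier U1≡ (U1⊆U0 b∈U1)
                                   (λ { refl → a∉U2 x∈ }) x∈m avoid x∈)

  claim : ∀ i → 2 ≤ i → suc i ≤ k → Claim i
  claim = <-rec _ step

lemma2p7 : {A : Set} (_≟_ : DecidableEquality A) (n k : ℕ) → 3 ≤ n → 3 ≤ k →
    (a : ℕ → A) →
    (∀ i j → 1 ≤ i → i ≤ n → 1 ≤ j → j ≤ n → a i ≡ a j → i ≡ j) →
    (w : List A) → (u : ℕ → List A) →
    (∀ x → x ∈ w → Σ ℕ λ i → (1 ≤ i) × (i ≤ n) × (x ≡ a i)) →
    w ≡ intercalate (a 1 ∷ []) (applyUpTo (λ j → u (suc j)) k) →
    (∀ i → 1 ≤ i → i ≤ k → a 1 ∉ u i) →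
    (∀ x → (x ∈ u 1) ⇔ (Σ ℕ λ i → (2 ≤ i) × (i ≤ n) × (x ≡ a i))) →
    Rich _≟_ w → SquareFree w →
    ∀ i → 2 ≤ i → i + 1 ≤ k →
      Σ (List A) λ v → Σ A λ b →
        (u i ≡ v ++ b ∷ reverse v) ×
        (∀ x → x ∈ u (i + 1) → (x ∈ u i) × (x ≢ b))
lemma2p7 {A} _≟_ n k _ _ a _ w u letters w≡ a₁-free u₁-letters rich square-free i 2≤i i+1≤k
  with Argument.claim _≟_ (a 1) u k w a₁-free in-u₁ spans returns squares i 2≤i (subst (_≤ k) (+-comm i 1) i+1≤k)
  where
  open Framing (a 1)
  open Blocks (a 1) u

  w-blocks : w ≡ join (window 1 k)
  w-blocks = trans w≡ (cong join (window-applyUpTo (λ j → u (suc j)) 1 k λ j → cong u (+-comm 1 j)))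

  spans : ∀ p n → 1 ≤ p → n + suc p ≤ k → Factor (frame (u p) (window (suc p) n) (u (n + suc p))) w
  spans p n 1≤p bound = subst (Factor _) (sym w-blocks) (span-factor 1≤p bound)

  -- every letter of a block other than a 1 is one of a 2, …, a n, hence occurs in u 1
  in-u₁ : ∀ i {x} → 1 ≤ i → i ≤ k → x ∈ u i → x ∈ u 1
  in-u₁ i {x} 1≤i i≤k x∈
    with letters x (∈-factor x∈ (subst (Factor (u i)) (sym w-blocks) (window-factor 1≤i (s≤s i≤k))))
  ... | suc zero , _ , _ , refl = ⊥-elim (a₁-free i 1≤i i≤k x∈)
  ... | suc (suc j) , _ , j≤n , x≡ = Equivalence.from (u₁-letters x) (suc (suc j) , s≤s (s≤s z≤n) , j≤n , x≡)

  returns : ∀ {x g} → x ∉ g → Factor (x ∷ g ++ x ∷ []) w → g ≡ reverse g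
  returns = RichWords.rich-returns _≟_ rich

  squares : ∀ {U} → Factor (U ++ U) w → U ≡ []
  squares {[]} _ = refl
  squares {c ∷ U} (p , s , eq) = ⊥-elim (square-free (p , c ∷ U , s , (λ ()) , eq))
... | v , b , uᵢ≡ , next = v , b , uᵢ≡ , λ x x∈ → next x (subst (λ j → x ∈ u j) (+-comm i 1) x∈)
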